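{- Let $k\geq1$ and let $\phi=Q_1x_1\dots Q_mx_m.\psi$ be a prenex $\mathsf{SL}^k$ formula with $Q_i\in\{\forall,\exists\}$ for $i=1,\dots,m$ and with no free variables, where $\psi$ is a boolean combination of test formulae of the forms $x\approx y$, $x\hookrightarrow(y_1,\dots,y_k)$, $\mathsf{alloc}(x)$ and $|h|\geq n$. Then the following are equivalent: (1) $\phi$ has an infinite model; (2) $\phi\wedge\lambda_m$ has a finite model.
   Context: An $\mathsf{SL}$-structure (for $k$ selectors) is a triple $(U,s,h)$ with $U$ a countable set, $s:\mathsf{Var}\rightharpoonup U$ a store, and $h:U\rightharpoonup U^k$ a partial map with finite domain (the heap); it is finite iff $U$ is finite, infinite otherwise. Let $\mathrm{elems}(h)$ be the set of locations in $\mathrm{dom}(h)$ or occurring as a component of some $h(\ell)$. Test formulae semantics: $x\approx y$ iff $s(x)=s(y)$; $x\hookrightarrow(y_1,\dots,y_k)$ iff $s(x)\in\mathrm{dom}(h)$ and $h(s(x))=(s(y_1),\dots,s(y_k))$; $\mathsf{alloc}(x)$ iff $s(x)\in\mathrm{dom}(h)$; $|h|\geq n$ ($n\in\mathbb{N}\cup\{\infty\}$) iff $|\mathrm{dom}(h)|\geq n$ (false for $n=\infty$). Quantifiers range over $U$. For $p\in\mathbb{N}$, $\lambda_p$ is the formula $\exists x_1,\dots,x_p.\ (\bigwedge_{i=1}^p\bigwedge_{j=1}^{i-1}\neg x_i\approx x_j \wedge \bigwedge_{i=1}^p \neg\, x_i\in h)$, where $x\in h$ abbreviates $\exists y_0,y_1,\dots,y_k.\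 (y_0\hookrightarrow(y_1,\dots,y_k)\wedge\bigvee_{i=0}^k x\approx y_i)$; thus $(U,s,h)\models\lambda_p$ iff $|U\setminus\mathrm{elems}(h)|\geq p$. -}

module Defs where

open import Level using (Level) renaming (zero to lzero; suc to lsuc)
open import Data.Nat using (ℕ; zero; suc; _+_; _≥_; _≟_)
open import Data.Fin using (Fin)
open import Data.Maybe using (Maybe; just; nothing)
open import Data.List using (List; []; _∷_; length; map)
open import Data.List.Membership.Propositional using (_∈_)
open import Data.List.Relation.Unary.AllPairs using (AllPairs)
open import Data.Vec using (Vec; []; _∷_)
import Data.Vec.Membership.Propositional as VecMem
import Data.Vec as Vec
open import Data.Product using (Σ; ∃; ∃-syntax; _×_; _,_; proj₁)
open import Data.Sum using (_⊎_)
open import Data.Unit using (⊤)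
open import Data.Empty using (⊥)
open import Function using (Injective)
open import Function.Bundles using (_↔_)
open import Relation.Nullary using (¬_; yes; no)
open import Relation.Binary.PropositionalEquality using (_≡_; _≢_)

Var : Set
Var = ℕ

-- A heap is a finite partial map U ⇀ U^k, represented by its graph:
-- a finite list of (location , record) pairs with pairwise distinct
-- locations.  dom(h) = the set of first components.
record Heap (U : Set) (k : ℕ) : Set where
  field
    cells    : List (U × Vec U k)
    distinct : AllPairs (λ c d → proj₁ c ≢ proj₁ d) cells

_∈dom_ : {U : Set} {k : ℕ} → U → Heap U k → Set
ℓ ∈dom h = ∃[ v ] ((ℓ , v) ∈ Heap.cells h)

∣_∣ₕ : {U : Set} {k : ℕ} → Heap U k → ℕ
∣ h ∣ₕ = length (Heap.cells h)

-- SL-structure (U , s , h) with U countable (injects into ℕ) and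
-- s : Var ⇀ U a partial store.
record SLStructure (k : ℕ) : Set₁ where
  field
    U        : Set
    code     : U → ℕ
    code-inj : Injective _≡_ _≡_ code
    store    : Var → Maybe U
    heap     : Heap U k

Finite : {k : ℕ} → SLStructure k → Set
Finite S = ∃[ n ] (SLStructure.U S ↔ Fin n)

Infinite : {k : ℕ} → SLStructure k → Set
Infinite S = ¬ Finite S

data ℕ∞ : Set where
  fin : ℕ → ℕ∞
  ∞   : ℕ∞

data Form (k : ℕ) : Set where
  _≈ᶠ_    : Var → Var → Form k
  _↪ᶠ_    : Var → Vec Var k → Form k
  allocᶠ  : Var → Form k
  sizeGe  : ℕ∞ → Form k
  ⊤ᶠ      : Form k
  ¬ᶠ_     : Form k → Form k
  _∧ᶠ_    : Form k → Form k → Form k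
  _∨ᶠ_    : Form k → Form k → Form k
  ∀ᶠ      : Var → Form k → Form k
  ∃ᶠ      : Var → Form k → Form k

data QF {k : ℕ} : Form k → Set where
  eq    : ∀ x y → QF (x ≈ᶠ y)
  pto   : ∀ x ys → QF (x ↪ᶠ ys)
  alloc : ∀ x → QF (allocᶠ x)
  size  : ∀ n → QF (sizeGe n)
  top   : QF ⊤ᶠ
  neg   : ∀ {φ} → QF φ → QF (¬ᶠ φ)
  conj  : ∀ {φ ψ} → QF φ → QF ψ → QF (φ ∧ᶠ ψ)
  disj  : ∀ {φ ψ} → QF φ → QF ψ → QF (φ ∨ᶠ ψ)

data Quant : Set where
  ∀q ∃q : Quant

prenex : {k : ℕ} → List (Quant × Var) → Form k → Form k
prenex []             ψ = ψ
prenex ((∀q , x) ∷ qs) ψ = ∀ᶠ x (prenex qs ψ)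
prenex ((∃q , x) ∷ qs) ψ = ∃ᶠ x (prenex qs ψ)

data FreeIn {k : ℕ} (z : Var) : Form k → Set where
  eqˡ    : ∀ {y} → FreeIn z (z ≈ᶠ y)
  eqʳ    : ∀ {x} → FreeIn z (x ≈ᶠ z)
  ptoˡ   : ∀ {ys} → FreeIn z (z ↪ᶠ ys)
  ptoʳ   : ∀ {x ys} → VecMem._∈_ z ys → FreeIn z (x ↪ᶠ ys)
  alloc  : FreeIn z (allocᶠ z)
  neg    : ∀ {φ} → FreeIn z φ → FreeIn z (¬ᶠ φ)
  conjˡ  : ∀ {φ ψ} → FreeIn z φ → FreeIn z (φ ∧ᶠ ψ)
  conjʳ  : ∀ {φ ψ} → FreeIn z ψ → FreeIn z (φ ∧ᶠ ψ)
  disjˡ  : ∀ {φ ψ} → FreeIn z φ → FreeIn z (φ ∨ᶠ ψ)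
  disjʳ  : ∀ {φ ψ} → FreeIn z ψ → FreeIn z (φ ∨ᶠ ψ)
  all    : ∀ {x φ} → z ≢ x → FreeIn z φ → FreeIn z (∀ᶠ x φ)
  ex     : ∀ {x φ} → z ≢ x → FreeIn z φ → FreeIn z (∃ᶠ x φ)

Closed : {k : ℕ} → Form k → Set
Closed φ = ∀ z → ¬ FreeIn z φ

_[_↦_] : {U : Set} → (Var → Maybe U) → Var → U → (Var → Maybe U)
(s [ x ↦ u ]) y with y ≟ x
... | yes _ = just u
... | no  _ = s y

_≥∞_ : ℕ → ℕ∞ → Set
m ≥∞ fin n = m ≥ n
m ≥∞ ∞     = ⊥

module _ {k : ℕ} (S : SLStructure k) where
  open SLStructure S

  sat : (Var → Maybe U) → Form k → Set
  sat s (x ≈ᶠ y)   = ∃[ u ] (s x ≡ just u × s y ≡ just u)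
  sat s (x ↪ᶠ ys)  = ∃[ ℓ ] ∃[ v ] (s x ≡ just ℓ × (ℓ , v) ∈ Heap.cells heap
                                    × Vec.map s ys ≡ Vec.map just v)
  sat s (allocᶠ x) = ∃[ ℓ ] (s x ≡ just ℓ × ℓ ∈dom heap)
  sat s (sizeGe n) = ∣ heap ∣ₕ ≥∞ n
  sat s ⊤ᶠ         = ⊤
  sat s (¬ᶠ φ)     = ¬ sat s φ
  sat s (φ ∧ᶠ ψ)   = sat s φ × sat s ψ
  sat s (φ ∨ᶠ ψ)   = sat s φ ⊎ sat s ψ
  sat s (∀ᶠ x φ)   = (u : U) → sat (s [ x ↦ u ]) φ
  sat s (∃ᶠ x φ)   = Σ U λ u → sat (s [ x ↦ u ]) φ

_⊨_ : {k : ℕ} → SLStructure k → Form k → Set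
S ⊨ φ = sat S (SLStructure.store S) φ

HasInfiniteModel : {k : ℕ} → Form k → Set₁
HasInfiniteModel {k} φ = Σ (SLStructure k) λ S → Infinite S × S ⊨ φ

HasFiniteModel : {k : ℕ} → Form k → Set₁
HasFiniteModel {k} φ = Σ (SLStructure k) λ S → Finite S × S ⊨ φ

-- λ_p, built syntactically as in the paper.
-- Variables: x_i = i (1 ≤ i ≤ p, we use 0..p-1), y_j = p + j (0 ≤ j ≤ k).

⋀ : {k : ℕ} → List (Form k) → Form k
⋀ []       = ⊤ᶠ
⋀ (φ ∷ φs) = φ ∧ᶠ ⋀ φs

⋁₁ : {k : ℕ} → Form k → List (Form k) → Form k
⋁₁ φ []       = φ
⋁₁ φ (ψ ∷ ψs) = φ ∨ᶠ ⋁₁ ψ ψs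

range : ℕ → List ℕ
range zero    = []
range (suc n) = range n Data.List.++ (n ∷ [])

∃many : {k : ℕ} → List Var → Form k → Form k
∃many []       φ = φ
∃many (x ∷ xs) φ = ∃ᶠ x (∃many xs φ)

-- x ∈ h, with y_0 … y_k the variables base , … , base + k
inHeap : (k : ℕ) → Var → Var → Form k
inHeap k base x =
  ∃many (map (base +_) (range (suc k)))
    ((base ↪ᶠ Vec.tabulate (λ i → base + suc (Data.Fin.toℕ i)))
      ∧ᶠ ⋁₁ (x ≈ᶠ base) (map (λ j → x ≈ᶠ (base + suc j)) (range k)))

lambdaF : (k : ℕ) → ℕ → Form k
lambdaF k p =
  ∃many (range p)
    ((⋀ (Data.List.concatMap (λ i → map (λ j → ¬ᶠ (i ≈ᶠ j)) (range i)) (range p)))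
      ∧ᶠ ⋀ (map (λ i → ¬ᶠ inHeap k p i) (range p)))

module Submission where

-- The heart is a transfer lemma (module Transfer): if a structure B embeds
-- into A along e, A's heap is the image of B's heap, and both structures
-- have m pairwise distinct locations outside elems(h), then A and B satisfy
-- the same closed prenex formulae with at most m quantifiers.  It is an
-- Ehrenfeucht–Fraïssé argument: locations in the heaps are matched along
-- e, those outside are matched arbitrarily, and m unused locations on each
-- side suffice to answer every quantifier.  Then:
--   (2) ⇒ (1)  adjoin ℕ to a finite model of φ ∧ λ_m (module Widen);
--   (1) ⇒ (2)  collapse an infinite model to elems(h) plus m + 1 spare
--              points (module Collapse).  The fresh locations needed to
--              embed the collapse back are only available under double
--              negation, which satisfaction in a finite structure, being
--              decidable (module Decide), absorbs.

open import Defs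
open import Data.Nat using (ℕ; _≤_)
open import Data.List using (List; length)
open import Data.Product using (_×_)
open import Function.Bundles using (_⇔_)

open import Level using () renaming (zero to lzero)
open import Data.Nat as ℕ using (zero; suc; _+_; _*_; _<_; _∸_; z≤n; s≤s)
import Data.Nat.Properties as ℕP
open import Data.Fin as F using (Fin; toℕ)
import Data.Fin.Properties as FP
open import Data.Maybe as Maybe using (Maybe; just; nothing)
import Data.Maybe.Properties as MaybeP
open import Data.List as L using ([]; _∷_; map; _++_)
import Data.List.Properties as LP
open import Data.List.Relation.Unary.Any as Any using (Any; here; there)
import Data.List.Relation.Unary.Any.Properties as AnyP
open import Data.List.Relation.Unary.All as All using (All)
import Data.List.Relation.Unary.All.Properties as AllP
open import Data.List.Relation.Unary.AllPairs as AP using (AllPairs)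
import Data.List.Relation.Unary.AllPairs.Properties as APP
import Data.List.Relation.Unary.Unique.DecPropositional.Properties as UniqueP
open import Data.List.Membership.Propositional using (_∈_; _∉_; find)
import Data.List.Membership.Propositional.Properties as ∈P
import Data.List.Membership.DecPropositional as DecMembership
open import Data.Vec as V using (Vec)
import Data.Vec.Properties as VP
import Data.Vec.Functional as VF
import Data.Vec.Relation.Unary.Any as VAny
import Data.Vec.Relation.Unary.Any.Properties as VAnyP
import Data.Vec.Membership.Propositional as VM
import Data.Vec.Membership.Propositional.Properties as VMP
open import Data.Product using (Σ; ∃; ∃₂; _,_; proj₁; proj₂)
open import Data.Product.Function.NonDependent.Propositional using (_×-⇔_)
open import Data.Sum using (_⊎_; inj₁; inj₂)
import Data.Sum.Properties as SumP
open import Data.Sum.Function.Propositional using (_⊎-⇔_)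
open import Data.Unit using (tt)
open import Function using (Injective; _∘_; id; mk⇔; Equivalence)
open import Function.Related.TypeIsomorphisms using (¬-cong-⇔)
open import Function.Bundles using (_↔_; Inverse; Injection; mk↔ₛ′)
open import Function.Properties.Inverse using (↔⇒↣)
open import Relation.Nullary using (¬_; Dec; yes; no; contradiction)
open import Relation.Nullary.Decidable using (¬?; map′; decidable-stable; _×-dec_; _⊎-dec_)
open import Relation.Nullary.Negation using (¬¬-Monad)
open import Effect.Monad using (RawMonad)
open import Relation.Binary.Definitions using (DecidableEquality; tri<; tri≈; tri>)
open import Relation.Binary.PropositionalEquality
  using (_≡_; _≢_; refl; sym; trans; cong; cong₂; subst; module ≡-Reasoning)

update-same : {U : Set} (s : Var → Maybe U) (x : Var) (u : U) → (s [ x ↦ u ]) x ≡ just u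
update-same s x u with x ℕ.≟ x
... | yes _   = refl
... | no x≢x = contradiction refl x≢x

update-other : {U : Set} (s : Var → Maybe U) (x y : Var) (u : U) → y ≢ x → (s [ x ↦ u ]) y ≡ s y
update-other s x y u y≢x with y ℕ.≟ x
... | yes y≡x = contradiction y≡x y≢x
... | no _    = refl

-- The universe of a structure is countable, hence has decidable equality.
decEq : {k : ℕ} (S : SLStructure k) → DecidableEquality (SLStructure.U S)
decEq S a b = map′ code-inj (cong code) (code a ℕ.≟ code b)
  where open SLStructure S

just-injective : {X : Set} {x y : X} → just x ≡ just y → x ≡ y
just-injective refl = refl

module _ {X : Set} (_≟_ : DecidableEquality X) where
  open DecMembership _≟_ using (_∈?_)

  avoid : {n : ℕ} (f : Fin n → X) → Injective _≡_ _≡_ f → (xs : List X) → length xs < n → ∃ λ j → f j ∉ xs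
  avoid {n} f f-inj xs short with FP.any? (λ j → ¬? (f j ∈? xs))
  ... | yes found = found
  ... | no none    = contradiction (FP.pigeonhole short position) no-collision
    where
    covered : ∀ j → f j ∈ xs
    covered j = decidable-stable (f j ∈? xs) (λ fj∉ → none (j , fj∉))
    position : Fin n → Fin (length xs)
    position j = Any.index (covered j)
    no-collision : ¬ (∃₂ λ i j → i F.< j × position i ≡ position j)
    no-collision (i , j , i<j , pos≡) = FP.<-irrefl (f-inj fi≡fj) i<j
      where
      fi≡fj : f i ≡ f j
      fi≡fj = trans (AnyP.lookup-index (covered i))
                (trans (cong (L.lookup xs) pos≡) (sym (AnyP.lookup-index (covered j))))

vec-map-id-local : {X : Set} {n : ℕ} {f : X → X} (v : Vec X n) → (∀ {x} → x VM.∈ v → f x ≡ x) → V.map f v ≡ v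
vec-map-id-local V.[]       _     = refl
vec-map-id-local (x V.∷ v) fixed = cong₂ V._∷_ (fixed (VAny.here refl)) (vec-map-id-local v (fixed ∘ VAny.there))

AllPairs-map-within : {X Y : Set} {R : X → X → Set} {T : Y → Y → Set} {f : X → Y} (xs : List X)
                    → (∀ {x y} → x ∈ xs → y ∈ xs → R x y → T (f x) (f y)) → AllPairs R xs → AllPairs T (map f xs)
AllPairs-map-within []       _    AP.[]            = AP.[]
AllPairs-map-within (x ∷ xs) resp (x∼xs AP.∷ xs∼) =
  AllP.map⁺ (All.tabulate (λ y∈ → resp (here refl) (there y∈) (All.lookup x∼xs y∈)))
    AP.∷ AllPairs-map-within xs (λ x∈ y∈ → resp (there x∈) (there y∈)) xs∼

Cells : Set → ℕ → Set
Cells U k = List (U × Vec U k)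

elems : {U : Set} {k : ℕ} → Cells U k → List U
elems []             = []
elems ((ℓ , v) ∷ cs) = ℓ ∷ (V.toList v ++ elems cs)

dom⊆elems : {U : Set} {k : ℕ} {cs : Cells U k} {ℓ : U} {v : Vec U k} → (ℓ , v) ∈ cs → ℓ ∈ elems cs
dom⊆elems (here refl) = here refl
dom⊆elems {cs = (_ , v) ∷ _} (there p) = there (∈P.∈-++⁺ʳ (V.toList v) (dom⊆elems p))

ran⊆elems : {U : Set} {k : ℕ} {cs : Cells U k} {ℓ u : U} {v : Vec U k}
          → (ℓ , v) ∈ cs → u VM.∈ v → u ∈ elems cs
ran⊆elems (here refl) u∈v = there (∈P.∈-++⁺ˡ (VMP.∈-toList⁺ u∈v))
ran⊆elems {cs = (_ , v) ∷ _} (there p) u∈v = there (∈P.∈-++⁺ʳ (V.toList v) (ran⊆elems p u∈v))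

elems⁻ : {U : Set} {k : ℕ} (cs : Cells U k) {u : U}
       → u ∈ elems cs → ∃ λ c → c ∈ cs × (u ≡ proj₁ c ⊎ u VM.∈ proj₂ c)
elems⁻ ((ℓ , v) ∷ cs) (here u≡ℓ) = (ℓ , v) , here refl , inj₁ u≡ℓ
elems⁻ ((ℓ , v) ∷ cs) (there p) with ∈P.∈-++⁻ (V.toList v) p
... | inj₁ u∈v = (ℓ , v) , here refl , inj₂ (VMP.∈-toList⁻ u∈v)
... | inj₂ u∈cs with elems⁻ cs u∈cs
...   | c , c∈ , which = c , there c∈ , which

mapCell : {U W : Set} {k : ℕ} → (W → U) → W × Vec W k → U × Vec U k
mapCell e (ℓ , v) = e ℓ , V.map e v

elems-map : {U W : Set} {k : ℕ} (e : W → U) (cs : Cells W k)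
          → elems (map (mapCell e) cs) ≡ map e (elems cs)
elems-map e [] = refl
elems-map e ((ℓ , v) ∷ cs) = cong (e ℓ ∷_) (begin
  V.toList (V.map e v) ++ elems (map (mapCell e) cs) ≡⟨ cong₂ _++_ (VP.toList-map e v) (elems-map e cs) ⟩
  map e (V.toList v) ++ map e (elems cs)              ≡⟨ LP.map-++ e (V.toList v) (elems cs) ⟨
  map e (V.toList v ++ elems cs)                      ∎)
  where open ≡-Reasoning

-- The semantic content of λ_p: p pairwise distinct locations outside elems(h).
record Unused {k : ℕ} (S : SLStructure k) (p : ℕ) : Set where
  field
    loc     : Fin p → SLStructure.U S
    loc-inj : Injective _≡_ _≡_ loc
    loc-out : ∀ j → loc j ∉ elems (Heap.cells (SLStructure.heap S))

-- The proof is an Ehrenfeucht–Fraïssé game: a position is a finite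
-- partial bijection P between the universes pairing e b with b inside
-- the heaps and arbitrary locations outside them; quantifier-free
-- formulae cannot tell paired assignments apart, and a position with
-- fewer than m pairs can always be extended by one move on either side.

module Transfer {k : ℕ} (A B : SLStructure k)
  (e : SLStructure.U B → SLStructure.U A) (e-inj : Injective _≡_ _≡_ e)
  (heap-image : Heap.cells (SLStructure.heap A) ≡ map (mapCell e) (Heap.cells (SLStructure.heap B)))
  (m : ℕ) (unusedA : Unused A m) (unusedB : Unused B m)
  where

  private
    UA = SLStructure.U A
    UB = SLStructure.U B
    cA = Heap.cells (SLStructure.heap A)
    cB = Heap.cells (SLStructure.heap B)
    open Unused unusedA renaming (loc to freshA; loc-inj to freshA-inj; loc-out to freshA-out)
    open Unused unusedB renaming (loc to freshB; loc-inj to freshB-inj; loc-out to freshB-out)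

  cellB⇒A : ∀ {b w} → (b , w) ∈ cB → (e b , V.map e w) ∈ cA
  cellB⇒A b∈ = subst (_ ∈_) (sym heap-image) (∈P.∈-map⁺ (mapCell e) b∈)

  cellA⇒B : ∀ {ℓ v} → (ℓ , v) ∈ cA → ∃₂ λ b w → (b , w) ∈ cB × ℓ ≡ e b × v ≡ V.map e w
  cellA⇒B ℓ∈ with ∈P.∈-map⁻ (mapCell e) (subst (_ ∈_) heap-image ℓ∈)
  ... | (b , w) , b∈ , refl = b , w , b∈ , refl , refl

  elems-image : elems cA ≡ map e (elems cB)
  elems-image = trans (cong elems heap-image) (elems-map e cB)

  elemsB⇒A : ∀ {b} → b ∈ elems cB → e b ∈ elems cA
  elemsB⇒A b∈ = subst (_ ∈_) (sym elems-image) (∈P.∈-map⁺ e b∈)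

  elemsA⇒B : ∀ {a} → a ∈ elems cA → ∃ λ b → a ≡ e b × b ∈ elems cB
  elemsA⇒B a∈ with ∈P.∈-map⁻ e (subst (_ ∈_) elems-image a∈)
  ... | b , b∈ , a≡eb = b , a≡eb , b∈

  size-eq : length cA ≡ length cB
  size-eq = trans (cong length heap-image) (LP.length-map (mapCell e) cB)

  Corr : UA → UB → Set
  Corr a b = a ≡ e b ⊎ (a ∉ elems cA × b ∉ elems cB)

  Pairs : Set
  Pairs = List (UA × UB)

  Compatible : UA → UB → Pairs → Set
  Compatible a b P = ∀ {a′ b′} → (a′ , b′) ∈ P → (a ≡ a′ → b ≡ b′) × (b ≡ b′ → a ≡ a′)

  record Position (P : Pairs) : Set where
    field
      corr : ∀ {a b} → (a , b) ∈ P → Corr a b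
      bij  : ∀ {a b} → (a , b) ∈ P → Compatible a b P

  open Position

  start : Position []
  start = record { corr = λ () ; bij = λ () }

  play : ∀ {a b P} → Position P → Corr a b → Compatible a b P → Position ((a , b) ∷ P)
  play M c k = record { corr = corr′ ; bij = bij′ }
    where
    corr′ : ∀ {a b} → (a , b) ∈ _ → Corr a b
    corr′ (here refl) = c
    corr′ (there p)   = corr M p
    bij′ : ∀ {a b} → (a , b) ∈ _ → Compatible a b _
    bij′ (here refl) (here refl) = (λ _ → refl) , (λ _ → refl)
    bij′ (here refl) (there q)   = k q
    bij′ (there p)   (here refl) = let f , g = k p in sym ∘ f ∘ sym , sym ∘ g ∘ sym
    bij′ (there p)   (there q)   = bij M p q

  Agree : Pairs → (Var → Maybe UA) → (Var → Maybe UB) → Var → Set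
  Agree P s t z = (s z ≡ nothing × t z ≡ nothing)
                ⊎ (∃₂ λ a b → (a , b) ∈ P × s z ≡ just a × t z ≡ just b)

  Agrees : Pairs → (Var → Maybe UA) → (Var → Maybe UB) → Form k → Set
  Agrees P s t φ = ∀ z → FreeIn z φ → Agree P s t z

  agrees-update : ∀ {P a b x φ ψ} (s : Var → Maybe UA) (t : Var → Maybe UB)
                → (∀ {z} → z ≢ x → FreeIn z φ → FreeIn z ψ)
                → Agrees P s t ψ → Agrees ((a , b) ∷ P) (s [ x ↦ a ]) (t [ x ↦ b ]) φ
  agrees-update {P} {a} {b} {x} s t bound ag z z∈φ = by-cases (z ℕ.≟ x)
    where
    by-cases : Dec (z ≡ x) → Agree ((a , b) ∷ P) (s [ x ↦ a ]) (t [ x ↦ b ]) z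
    by-cases (yes refl) = inj₂ (a , b , here refl , update-same s x a , update-same t x b)
    by-cases (no z≢x) with ag z (bound z≢x z∈φ)
    ... | inj₁ (sz , tz) = inj₁ (trans (update-other s x z a z≢x) sz , trans (update-other t x z b z≢x) tz)
    ... | inj₂ (a′ , b′ , p , sz , tz) =
          inj₂ (a′ , b′ , there p , trans (update-other s x z a z≢x) sz , trans (update-other t x z b z≢x) tz)

  module _ {P : Pairs} (M : Position P) (s : Var → Maybe UA) (t : Var → Maybe UB) where

    partnerA : ∀ {z a} → Agree P s t z → s z ≡ just a → ∃ λ b → (a , b) ∈ P × t z ≡ just b
    partnerA (inj₁ (sz , _)) sz≡a = contradiction (trans (sym sz≡a) sz) λ ()
    partnerA (inj₂ (_ , b , p , sz , tz)) sz≡a with just-injective (trans (sym sz≡a) sz)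
    ... | refl = b , p , tz

    partnerB : ∀ {z b} → Agree P s t z → t z ≡ just b → ∃ λ a → (a , b) ∈ P × s z ≡ just a
    partnerB (inj₁ (_ , tz)) tz≡b = contradiction (trans (sym tz≡b) tz) λ ()
    partnerB (inj₂ (a , _ , p , sz , tz)) tz≡b with just-injective (trans (sym tz≡b) tz)
    ... | refl = a , p , sz

    heapA⇒B : ∀ {z b} → Agree P s t z → s z ≡ just (e b) → b ∈ elems cB → t z ≡ just b
    heapA⇒B ag sz b∈ with partnerA ag sz
    ... | b′ , p , tz with corr M p
    ...   | inj₁ eb≡eb′     = trans tz (cong just (sym (e-inj eb≡eb′)))
    ...   | inj₂ (eb∉ , _) = contradiction (elemsB⇒A b∈) eb∉

    heapB⇒A : ∀ {z b} → Agree P s t z → t z ≡ just b → b ∈ elems cB → s z ≡ just (e b)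
    heapB⇒A ag tz b∈ with partnerB ag tz
    ... | a , p , sz with corr M p
    ...   | inj₁ refl      = sz
    ...   | inj₂ (_ , b∉) = contradiction b∈ b∉

    argsA⇒B : ∀ {n} (ys : Vec Var n) (w : Vec UB n)
            → (∀ {y} → y VM.∈ ys → Agree P s t y) → (∀ {b} → b VM.∈ w → b ∈ elems cB)
            → V.map s ys ≡ V.map just (V.map e w) → V.map t ys ≡ V.map just w
    argsA⇒B V.[] V.[] _ _ _ = refl
    argsA⇒B (y V.∷ ys) (b V.∷ w) ag w⊆ sys with VP.∷-injective sys
    ... | sy , sys′ = cong₂ V._∷_ (heapA⇒B (ag (VAny.here refl)) sy (w⊆ (VAny.here refl)))
                                  (argsA⇒B ys w (ag ∘ VAny.there) (w⊆ ∘ VAny.there) sys′)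

    argsB⇒A : ∀ {n} (ys : Vec Var n) (w : Vec UB n)
            → (∀ {y} → y VM.∈ ys → Agree P s t y) → (∀ {b} → b VM.∈ w → b ∈ elems cB)
            → V.map t ys ≡ V.map just w → V.map s ys ≡ V.map just (V.map e w)
    argsB⇒A V.[] V.[] _ _ _ = refl
    argsB⇒A (y V.∷ ys) (b V.∷ w) ag w⊆ tys with VP.∷-injective tys
    ... | ty , tys′ = cong₂ V._∷_ (heapB⇒A (ag (VAny.here refl)) ty (w⊆ (VAny.here refl)))
                                  (argsB⇒A ys w (ag ∘ VAny.there) (w⊆ ∘ VAny.there) tys′)

    ≈-transfer : ∀ {x y} → Agrees P s t (x ≈ᶠ y) → sat A s (x ≈ᶠ y) ⇔ sat B t (x ≈ᶠ y)
    ≈-transfer {x} {y} ag = mk⇔ to from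
      where
      to : sat A s (x ≈ᶠ y) → sat B t (x ≈ᶠ y)
      to (a , sx , sy) with partnerA (ag x eqˡ) sx | partnerA (ag y eqʳ) sy
      ... | b , p , tx | b′ , p′ , ty = b , tx , trans ty (cong just (sym (proj₁ (bij M p p′) refl)))
      from : sat B t (x ≈ᶠ y) → sat A s (x ≈ᶠ y)
      from (b , tx , ty) with partnerB (ag x eqˡ) tx | partnerB (ag y eqʳ) ty
      ... | a , p , sx | a′ , p′ , sy = a , sx , trans sy (cong just (sym (proj₂ (bij M p p′) refl)))

    ↪-transfer : ∀ {x ys} → Agrees P s t (x ↪ᶠ ys) → sat A s (x ↪ᶠ ys) ⇔ sat B t (x ↪ᶠ ys)
    ↪-transfer {x} {ys} ag = mk⇔ to from
      where
      agys : ∀ {y} → y VM.∈ ys → Agree P s t y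
      agys y∈ = ag _ (ptoʳ y∈)
      to : sat A s (x ↪ᶠ ys) → sat B t (x ↪ᶠ ys)
      to (ℓ , v , sx , ℓ∈ , sys) with cellA⇒B ℓ∈
      ... | b , w , b∈ , refl , refl =
            b , w , heapA⇒B (ag x ptoˡ) sx (dom⊆elems b∈) , b∈ , argsA⇒B ys w agys (ran⊆elems b∈) sys
      from : sat B t (x ↪ᶠ ys) → sat A s (x ↪ᶠ ys)
      from (b , w , tx , b∈ , tys) =
        e b , V.map e w , heapB⇒A (ag x ptoˡ) tx (dom⊆elems b∈) , cellB⇒A b∈ , argsB⇒A ys w agys (ran⊆elems b∈) tys

    alloc-transfer : ∀ {x} → Agrees P s t (allocᶠ x) → sat A s (allocᶠ x) ⇔ sat B t (allocᶠ x)
    alloc-transfer {x} ag = mk⇔ to from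
      where
      to : sat A s (allocᶠ x) → sat B t (allocᶠ x)
      to (ℓ , sx , v , ℓ∈) with cellA⇒B ℓ∈
      ... | b , w , b∈ , refl , _ = b , heapA⇒B (ag x alloc) sx (dom⊆elems b∈) , w , b∈
      from : sat B t (allocᶠ x) → sat A s (allocᶠ x)
      from (b , tx , w , b∈) = e b , heapB⇒A (ag x alloc) tx (dom⊆elems b∈) , V.map e w , cellB⇒A b∈

    qf-transfer : ∀ {ψ} → QF ψ → Agrees P s t ψ → sat A s ψ ⇔ sat B t ψ
    qf-transfer (eq x y)   ag = ≈-transfer ag
    qf-transfer (pto x ys) ag = ↪-transfer ag
    qf-transfer (alloc x)  ag = alloc-transfer ag
    qf-transfer (size n)   _  = mk⇔ (subst (_≥∞ n) size-eq) (subst (_≥∞ n) (sym size-eq))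
    qf-transfer top        _  = mk⇔ id id
    qf-transfer (neg q)    ag = ¬-cong-⇔ (qf-transfer q (λ z → ag z ∘ neg))
    qf-transfer (conj q r) ag = qf-transfer q (λ z → ag z ∘ conjˡ) ×-⇔ qf-transfer r (λ z → ag z ∘ conjʳ)
    qf-transfer (disj q r) ag = qf-transfer q (λ z → ag z ∘ disjˡ) ⊎-⇔ qf-transfer r (λ z → ag z ∘ disjʳ)

  compatible-image : ∀ {P b} → Position P → b ∈ elems cB → Compatible (e b) b P
  compatible-image M b∈ p with corr M p
  ... | inj₁ refl          = e-inj , cong e
  ... | inj₂ (a′∉ , b′∉) = (λ { refl → contradiction (elemsB⇒A b∈) a′∉ })
                           , (λ { refl → contradiction b∈ b′∉ })

  compatible-new : ∀ {P a b} → a ∉ map proj₁ P → b ∉ map proj₂ P → Compatible a b P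
  compatible-new a∉ b∉ p = (λ { refl → contradiction (∈P.∈-map⁺ proj₁ p) a∉ })
                         , (λ { refl → contradiction (∈P.∈-map⁺ proj₂ p) b∉ })

  open DecMembership (decEq A) using () renaming (_∈?_ to _∈A?_)
  open DecMembership (decEq B) using () renaming (_∈?_ to _∈B?_)

  -- Forth: while fewer than m pairs are played, every a ∈ A gets a partner:
  -- e⁻¹ a inside the heap, its old partner if already played, else a fresh location.
  forth : ∀ {P} → Position P → length P < m → (a : UA) → ∃ λ b → Corr a b × Compatible a b P
  forth M room a with a ∈A? elems cA
  ... | yes a∈ with elemsA⇒B a∈
  ...   | b , refl , b∈ = b , inj₁ refl , compatible-image M b∈
  forth {P} M room a | no a∉ with a ∈A? map proj₁ P
  ... | yes played with ∈P.∈-map⁻ proj₁ played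
  ...   | (_ , b) , p , refl = b , corr M p , bij M p
  forth {P} M room a | no a∉ | no new
    with avoid (decEq B) freshB freshB-inj (map proj₂ P) (subst (_< m) (sym (LP.length-map proj₂ P)) room)
  ... | j , j∉ = freshB j , inj₂ (a∉ , freshB-out j) , compatible-new new j∉

  back : ∀ {P} → Position P → length P < m → (b : UB) → ∃ λ a → Corr a b × Compatible a b P
  back M room b with b ∈B? elems cB
  ... | yes b∈ = e b , inj₁ refl , compatible-image M b∈
  back {P} M room b | no b∉ with b ∈B? map proj₂ P
  ... | yes played with ∈P.∈-map⁻ proj₂ played
  ...   | (a , _) , p , refl = a , corr M p , bij M p
  back {P} M room b | no b∉ | no new
    with avoid (decEq A) freshA freshA-inj (map proj₁ P) (subst (_< m) (sym (LP.length-map proj₁ P)) room)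
  ... | j , j∉ = freshA j , inj₂ (freshA-out j , b∉) , compatible-new j∉ new

  room : ∀ {P : Pairs} {n} → length P + suc n ≤ m → length P < m
  room {P} budget = ℕP.<-≤-trans (ℕP.m<m+n (length P) (s≤s z≤n)) budget

  after-move : ∀ {P : Pairs} {n} (ab : UA × UB) → length P + suc n ≤ m → length (ab ∷ P) + n ≤ m
  after-move {P} {n} _ budget = subst (_≤ m) (ℕP.+-suc (length P) n) budget

  -- The game: from a position with enough budget, agreeing stores satisfy
  -- the same prenex formulae.  A ∀ on one side is answered by a move on the other.
  prenex-transfer : ∀ qs {ψ P} → QF ψ → Position P → length P + length qs ≤ m
                  → (s : Var → Maybe UA) (t : Var → Maybe UB) → Agrees P s t (prenex qs ψ)
                  → sat A s (prenex qs ψ) ⇔ sat B t (prenex qs ψ)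
  prenex-transfer [] q M _ s t ag = qf-transfer M s t q ag
  prenex-transfer ((∀q , x) ∷ qs) {ψ} {P} q M budget s t ag =
    mk⇔ (λ sA b → let a , c , k = back  M (room {P} {length qs} budget) b in Equivalence.to   (body c k) (sA a))
        (λ tB a → let b , c , k = forth M (room {P} {length qs} budget) a in Equivalence.from (body c k) (tB b))
    where
    body : ∀ {a b} → Corr a b → Compatible a b P
         → sat A (s [ x ↦ a ]) (prenex qs ψ) ⇔ sat B (t [ x ↦ b ]) (prenex qs ψ)
    body {a} {b} c k = prenex-transfer qs q (play M c k) (after-move {P} {length qs} (a , b) budget) _ _ (agrees-update s t all ag)
  prenex-transfer ((∃q , x) ∷ qs) {ψ} {P} q M budget s t ag =
    mk⇔ (λ { (a , sA) → let b , c , k = forth M (room {P} {length qs} budget) a in b , Equivalence.to   (body c k) sA })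
        (λ { (b , tB) → let a , c , k = back  M (room {P} {length qs} budget) b in a , Equivalence.from (body c k) tB })
    where
    body : ∀ {a b} → Corr a b → Compatible a b P
         → sat A (s [ x ↦ a ]) (prenex qs ψ) ⇔ sat B (t [ x ↦ b ]) (prenex qs ψ)
    body {a} {b} c k = prenex-transfer qs q (play M c k) (after-move {P} {length qs} (a , b) budget) _ _ (agrees-update s t ex ag)

  transfer : ∀ qs {ψ} → QF ψ → length qs ≤ m → Closed (prenex qs ψ)
           → (s : Var → Maybe UA) (t : Var → Maybe UB) → sat A s (prenex qs ψ) ⇔ sat B t (prenex qs ψ)
  transfer qs q short closed s t = prenex-transfer qs q start short s t (λ z z-free → contradiction z-free (closed z))

range⁺ : ∀ {j n} → j < n → j ∈ range n
range⁺ {j} {suc n} (s≤s j≤n) with ℕP.m≤n⇒m<n∨m≡n j≤n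
... | inj₁ j<n  = ∈P.∈-++⁺ˡ (range⁺ j<n)
... | inj₂ refl = ∈P.∈-++⁺ʳ (range n) (here refl)

range⁻ : ∀ {j n} → j ∈ range n → j < n
range⁻ {j} {suc n} j∈ with ∈P.∈-++⁻ (range n) j∈
... | inj₁ j∈′       = ℕP.m<n⇒m<1+n (range⁻ j∈′)
... | inj₂ (here refl) = ℕP.n<1+n n

bindAll : {U : Set} → (Var → Maybe U) → List Var → (Var → U) → (Var → Maybe U)
bindAll t []       g = t
bindAll t (x ∷ xs) g = bindAll (t [ x ↦ g x ]) xs g

bindAll-out : {U : Set} (t : Var → Maybe U) (xs : List Var) (g : Var → U) {y : Var}
            → y ∉ xs → bindAll t xs g y ≡ t y
bindAll-out t []       g _   = refl
bindAll-out t (x ∷ xs) g y∉ = trans (bindAll-out (t [ x ↦ g x ]) xs g (y∉ ∘ there))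
                                    (update-other t x _ (g x) (y∉ ∘ here))

open DecMembership ℕ._≟_ using () renaming (_∈?_ to _∈ℕ?_)

bindAll-in : {U : Set} (t : Var → Maybe U) (xs : List Var) (g : Var → U) {y : Var}
           → y ∈ xs → bindAll t xs g y ≡ just (g y)
bindAll-in t (x ∷ xs) g {y} y∈ with y ∈ℕ? xs
... | yes y∈xs = bindAll-in (t [ x ↦ g x ]) xs g y∈xs
... | no y∉xs with y∈
...   | here refl  = trans (bindAll-out (t [ x ↦ g x ]) xs g y∉xs) (update-same t x (g x))
...   | there y∈xs = contradiction y∈xs y∉xs

tabulate-values⁻ : {X : Set} {n : ℕ} (t : Var → Maybe X) (f : Fin n → Var) (v : Vec X n)
                 → V.map t (V.tabulate f) ≡ V.map just v → ∀ i → t (f i) ≡ just (V.lookup v i)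
tabulate-values⁻ t f v reads i = begin
  t (f i)                             ≡⟨ cong t (VP.lookup∘tabulate f i) ⟨
  t (V.lookup (V.tabulate f) i)       ≡⟨ VP.lookup-map i t (V.tabulate f) ⟨
  V.lookup (V.map t (V.tabulate f)) i ≡⟨ cong (λ w → V.lookup w i) reads ⟩
  V.lookup (V.map just v) i           ≡⟨ VP.lookup-map i just v ⟩
  just (V.lookup v i)                 ∎
  where open ≡-Reasoning

tabulate-values⁺ : {X : Set} {n : ℕ} (t : Var → Maybe X) (f : Fin n → Var) (v : Vec X n)
                 → (∀ i → t (f i) ≡ just (V.lookup v i)) → V.map t (V.tabulate f) ≡ V.map just v
tabulate-values⁺ t f v reads = begin
  V.map t (V.tabulate f)             ≡⟨ VP.tabulate-∘ t f ⟨
  V.tabulate (t ∘ f)                 ≡⟨ VP.tabulate-cong reads ⟩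
  V.tabulate (just ∘ V.lookup v)     ≡⟨ VP.tabulate-∘ just (V.lookup v) ⟩
  V.map just (V.tabulate (V.lookup v)) ≡⟨ cong (V.map just) (VP.tabulate∘lookup v) ⟩
  V.map just v                       ∎
  where open ≡-Reasoning

lookupOr : {X : Set} {n : ℕ} → Vec X n → ℕ → X → X
lookupOr V.[]       j       d = d
lookupOr (x V.∷ xs) zero    d = x
lookupOr (x V.∷ xs) (suc j) d = lookupOr xs j d

lookupOr-toℕ : {X : Set} {n : ℕ} (xs : Vec X n) (i : Fin n) (d : X) → lookupOr xs (toℕ i) d ≡ V.lookup xs i
lookupOr-toℕ (x V.∷ xs) F.zero    d = refl
lookupOr-toℕ (x V.∷ xs) (F.suc i) d = lookupOr-toℕ xs i d

module LambdaSemantics {k : ℕ} (S : SLStructure k) where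
  open SLStructure S
  private
    cs = Heap.cells heap
    Store = Var → Maybe U

  ∃many-intro : ∀ (t : Store) xs g φ → sat S (bindAll t xs g) φ → sat S t (∃many xs φ)
  ∃many-intro t []       g φ φ-holds = φ-holds
  ∃many-intro t (x ∷ xs) g φ φ-holds = g x , ∃many-intro (t [ x ↦ g x ]) xs g φ φ-holds

  ∃many-elim : ∀ (t : Store) xs φ → sat S t (∃many xs φ)
             → Σ Store λ t′ → (∀ {y} → y ∉ xs → t′ y ≡ t y)
                          × (∀ {y} → y ∈ xs → ∃ λ u → t′ y ≡ just u)
                          × sat S t′ φ
  ∃many-elim t []       φ φ-holds       = t , (λ _ → refl) , (λ ()) , φ-holds
  ∃many-elim t (x ∷ xs) φ (u , φ-holds) with ∃many-elim (t [ x ↦ u ]) xs φ φ-holds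
  ... | t′ , same , bound , φ-holds′ = t′ , same′ , bound′ , φ-holds′
    where
    same′ : ∀ {y} → y ∉ x ∷ xs → t′ y ≡ t y
    same′ y∉ = trans (same (y∉ ∘ there)) (update-other t x _ u (y∉ ∘ here))
    bound′ : ∀ {y} → y ∈ x ∷ xs → ∃ λ u′ → t′ y ≡ just u′
    bound′ {y} y∈ with y ∈ℕ? xs
    ... | yes y∈xs = bound y∈xs
    ... | no y∉xs with y∈
    ...   | here refl  = u , trans (same y∉xs) (update-same t x u)
    ...   | there y∈xs = contradiction y∈xs y∉xs

  ⋀-intro : ∀ (t : Store) φs → All (sat S t) φs → sat S t (⋀ φs)
  ⋀-intro t []       All.[]               = tt
  ⋀-intro t (φ ∷ φs) (φ-holds All.∷ rest) = φ-holds , ⋀-intro t φs rest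

  ⋀-elim : ∀ (t : Store) φs → sat S t (⋀ φs) → All (sat S t) φs
  ⋀-elim t []       _                = All.[]
  ⋀-elim t (φ ∷ φs) (φ-holds , rest) = φ-holds All.∷ ⋀-elim t φs rest

  ⋁-intro : ∀ (t : Store) φ ψs → sat S t φ ⊎ Any (sat S t) ψs → sat S t (⋁₁ φ ψs)
  ⋁-intro t φ []       (inj₁ φ-holds)         = φ-holds
  ⋁-intro t φ (ψ ∷ ψs) (inj₁ φ-holds)         = inj₁ φ-holds
  ⋁-intro t φ (ψ ∷ ψs) (inj₂ (here ψ-holds))  = inj₂ (⋁-intro t ψ ψs (inj₁ ψ-holds))
  ⋁-intro t φ (ψ ∷ ψs) (inj₂ (there ψs-hold)) = inj₂ (⋁-intro t ψ ψs (inj₂ ψs-hold))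

  ⋁-elim : ∀ (t : Store) φ ψs → sat S t (⋁₁ φ ψs) → sat S t φ ⊎ Any (sat S t) ψs
  ⋁-elim t φ []       φ-holds        = inj₁ φ-holds
  ⋁-elim t φ (ψ ∷ ψs) (inj₁ φ-holds) = inj₁ φ-holds
  ⋁-elim t φ (ψ ∷ ψs) (inj₂ rest) with ⋁-elim t ψ ψs rest
  ... | inj₁ ψ-holds  = inj₂ (here ψ-holds)
  ... | inj₂ ψs-hold = inj₂ (there ψs-hold)

  cellVars : ℕ → List Var
  cellVars base = map (base +_) (range (suc k))

  componentVar : ℕ → Fin k → Var
  componentVar base i = base + suc (toℕ i)

  cellPto : ℕ → Form k
  cellPto base = base ↪ᶠ V.tabulate (componentVar base)

  componentEqs : ℕ → Var → List (Form k)
  componentEqs base x = map (λ j → x ≈ᶠ (base + suc j)) (range k)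

  below-cellVars : ∀ {x base} → x < base → x ∉ cellVars base
  below-cellVars {x} {base} x<base x∈ with ∈P.∈-map⁻ (base +_) x∈
  ... | j , _ , refl = ℕP.<⇒≱ x<base (ℕP.m≤m+n base j)

  base∈cellVars : ∀ {base} → base ∈ cellVars base
  base∈cellVars {base} = subst (_∈ cellVars base) (ℕP.+-identityʳ base) (∈P.∈-map⁺ (base +_) (range⁺ (s≤s z≤n)))

  component∈cellVars : ∀ {base} (i : Fin k) → componentVar base i ∈ cellVars base
  component∈cellVars {base} i = ∈P.∈-map⁺ (base +_) (range⁺ (s≤s (FP.toℕ<n i)))

  inHeap-sound : ∀ (t : Store) base x {u} → x < base → t x ≡ just u → sat S t (inHeap k base x) → u ∈ elems cs
  inHeap-sound t base x {u} x<base tx x∈h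
    with ∃many-elim t (cellVars base) (cellPto base ∧ᶠ ⋁₁ (x ≈ᶠ base) (componentEqs base x)) x∈h
  ... | t′ , same , _ , (ℓ , v , tb , ℓ∈ , tv) , which = by-case (⋁-elim t′ (x ≈ᶠ base) (componentEqs base x) which)
    where
    t′x : t′ x ≡ just u
    t′x = trans (same (below-cellVars x<base)) tx
    by-case : sat S t′ (x ≈ᶠ base) ⊎ Any (sat S t′) (componentEqs base x) → u ∈ elems cs
    by-case (inj₁ (w , xw , bw)) =
      subst (_∈ elems cs) (just-injective (trans (sym tb) (trans bw (trans (sym xw) t′x)))) (dom⊆elems ℓ∈)
    by-case (inj₂ some) with find (AnyP.map⁻ some)
    ... | j , j∈ , (w , xw , jw) = ran⊆elems ℓ∈ (subst (VM._∈ v) u≡vᵢ (VMP.∈-lookup i v))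
      where
      j<k = range⁻ j∈
      i = F.fromℕ< j<k
      u≡vᵢ : V.lookup v i ≡ u
      u≡vᵢ = just-injective (begin
        just (V.lookup v i)      ≡⟨ tabulate-values⁻ t′ (componentVar base) v tv i ⟨
        t′ (componentVar base i) ≡⟨ cong (λ j → t′ (base + suc j)) (FP.toℕ-fromℕ< j<k) ⟩
        t′ (base + suc j)        ≡⟨ trans jw (sym xw) ⟩
        t′ x                     ≡⟨ t′x ⟩
        just u                   ∎)
        where open ≡-Reasoning

  inHeap-complete : ∀ (t : Store) base x {u} → x < base → t x ≡ just u → u ∈ elems cs → sat S t (inHeap k base x)
  inHeap-complete t base x {u} x<base tx u∈ with elems⁻ cs u∈
  ... | (ℓ , v) , ℓ∈ , which =
        ∃many-intro t (cellVars base) cellValue (cellPto base ∧ᶠ ⋁₁ (x ≈ᶠ base) (componentEqs base x))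
          ((ℓ , v , t′base , ℓ∈ , tabulate-values⁺ t′ (componentVar base) v t′component)
          , ⋁-intro t′ (x ≈ᶠ base) (componentEqs base x) (by-case which))
    where
    -- Bind y₀ to the address ℓ of the cell and y_{i+1} to its i-th component.
    cellAt : ℕ → U
    cellAt zero    = ℓ
    cellAt (suc j) = lookupOr v j ℓ
    cellValue : Var → U
    cellValue y = cellAt (y ∸ base)
    t′ = bindAll t (cellVars base) cellValue
    t′x : t′ x ≡ just u
    t′x = trans (bindAll-out t (cellVars base) cellValue (below-cellVars x<base)) tx
    t′base : t′ base ≡ just ℓ
    t′base = trans (bindAll-in t (cellVars base) cellValue base∈cellVars)
                   (cong (just ∘ cellAt) (ℕP.n∸n≡0 base))
    t′component : ∀ i → t′ (componentVar base i) ≡ just (V.lookup v i)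
    t′component i = trans (bindAll-in t (cellVars base) cellValue (component∈cellVars i))
                          (cong just (trans (cong cellAt (ℕP.m+n∸m≡n base (suc (toℕ i)))) (lookupOr-toℕ v i ℓ)))
    by-case : u ≡ ℓ ⊎ u VM.∈ v → sat S t′ (x ≈ᶠ base) ⊎ Any (sat S t′) (componentEqs base x)
    by-case (inj₁ refl) = inj₁ (u , t′x , t′base)
    by-case (inj₂ u∈v)  = inj₂ (AnyP.map⁺ (Any.map (λ { refl → x≈yᵢ }) (range⁺ (FP.toℕ<n i))))
      where
      i = VAny.index u∈v
      x≈yᵢ : sat S t′ (x ≈ᶠ componentVar base i)
      x≈yᵢ = u , t′x , trans (t′component i) (cong just (sym (VAnyP.lookup-index u∈v)))

  distinctness : ℕ → List (Form k)
  distinctness p = L.concatMap (λ i → map (λ j → ¬ᶠ (i ≈ᶠ j)) (range i)) (range p)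

  outsideness : ℕ → List (Form k)
  outsideness p = map (λ i → ¬ᶠ inHeap k p i) (range p)

  distinct∈ : ∀ {i j p} → j < i → i < p → (¬ᶠ (i ≈ᶠ j)) ∈ distinctness p
  distinct∈ {i} j<i i<p = ∈P.∈-concatMap⁺ (λ i → map (λ j → ¬ᶠ (i ≈ᶠ j)) (range i))
    (Any.map (λ { refl → ∈P.∈-map⁺ (λ j → ¬ᶠ (i ≈ᶠ j)) (range⁺ j<i) }) (range⁺ i<p))

  λ-sound : ∀ (t : Store) p → sat S t (lambdaF k p) → Unused S p
  λ-sound t p λ-holds with ∃many-elim t (range p) (⋀ (distinctness p) ∧ᶠ ⋀ (outsideness p)) λ-holds
  ... | t′ , _ , bound , (distinct , outside) = record { loc = loc ; loc-inj = loc-inj ; loc-out = loc-out }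
    where
    loc : Fin p → U
    loc j = proj₁ (bound (range⁺ (FP.toℕ<n j)))
    t′-loc : ∀ j → t′ (toℕ j) ≡ just (loc j)
    t′-loc j = proj₂ (bound (range⁺ (FP.toℕ<n j)))
    ordered-distinct : ∀ {a b} → a F.< b → loc a ≢ loc b
    ordered-distinct {a} {b} a<b same =
      All.lookup (⋀-elim t′ (distinctness p) distinct) (distinct∈ a<b (FP.toℕ<n b))
        (loc a , trans (t′-loc b) (cong just (sym same)) , t′-loc a)
    loc-inj : Injective _≡_ _≡_ loc
    loc-inj {a} {b} same with FP.<-cmp a b
    ... | tri< a<b _ _ = contradiction same (ordered-distinct a<b)
    ... | tri≈ _ a≡b _ = a≡b
    ... | tri> _ _ b<a = contradiction (sym same) (ordered-distinct b<a)
    loc-out : ∀ j → loc j ∉ elems cs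
    loc-out j loc∈ =
      All.lookup (⋀-elim t′ (outsideness p) outside) (∈P.∈-map⁺ (λ i → ¬ᶠ inHeap k p i) (range⁺ (FP.toℕ<n j)))
        (inHeap-complete t′ p (toℕ j) (FP.toℕ<n j) (t′-loc j) loc∈)

  -- Binding xᵢ to the i-th unused location satisfies λ_p.
  λ-complete : ∀ (t : Store) p → Unused S p → sat S t (lambdaF k p)
  λ-complete t zero    _      = tt , tt
  λ-complete t (suc p) unused =
    ∃many-intro t (range (suc p)) value (⋀ (distinctness (suc p)) ∧ᶠ ⋀ (outsideness (suc p)))
      (⋀-intro t′ _ (All.tabulate distinct) , ⋀-intro t′ _ (All.tabulate outside))
    where
    open Unused unused
    value : Var → U
    value y = lookupOr (V.tabulate loc) y (loc F.zero)
    t′ = bindAll t (range (suc p)) value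
    t′-loc : ∀ {i} (i<p : i < suc p) → t′ i ≡ just (loc (F.fromℕ< i<p))
    t′-loc {i} i<p = trans (bindAll-in t (range (suc p)) value (range⁺ i<p)) (cong just (begin
      value i                                  ≡⟨ cong value (FP.toℕ-fromℕ< i<p) ⟨
      value (toℕ i′)                           ≡⟨ lookupOr-toℕ (V.tabulate loc) i′ (loc F.zero) ⟩
      V.lookup (V.tabulate loc) i′             ≡⟨ VP.lookup∘tabulate loc i′ ⟩
      loc i′                                   ∎))
      where
      open ≡-Reasoning
      i′ = F.fromℕ< i<p
    distinct : ∀ {φ} → φ ∈ distinctness (suc p) → sat S t′ φ
    distinct φ∈ with find (∈P.∈-concatMap⁻ (λ i → map (λ j → ¬ᶠ (i ≈ᶠ j)) (range i)) {range (suc p)} φ∈)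
    ... | i , i∈ , φ∈ᵢ with ∈P.∈-map⁻ (λ j → ¬ᶠ (i ≈ᶠ j)) φ∈ᵢ
    ... | j , j∈ , refl = λ { (w , iw , jw) → ℕP.<-irrefl (sym (i≡j iw jw)) j<i }
      where
      j<i = range⁻ j∈
      i<p = range⁻ i∈
      j<p = ℕP.<-trans j<i i<p
      i≡j : ∀ {w} → t′ i ≡ just w → t′ j ≡ just w → i ≡ j
      i≡j iw jw = FP.fromℕ<-injective i j i<p j<p
                    (loc-inj (just-injective (trans (sym (t′-loc i<p)) (trans iw (trans (sym jw) (t′-loc j<p))))))
    outside : ∀ {φ} → φ ∈ outsideness (suc p) → sat S t′ φ
    outside φ∈ with ∈P.∈-map⁻ (λ i → ¬ᶠ inHeap k (suc p) i) φ∈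
    ... | i , i∈ , refl = λ i∈h → loc-out (F.fromℕ< i<p) (inHeap-sound t′ (suc p) i i<p (t′-loc i<p) i∈h)
      where i<p = range⁻ i∈

-- Adjoining ℕ to the universe of a model of φ ∧ λ_m as fresh,
-- unallocated locations yields an infinite structure with the same heap;
-- both have m unused locations, so Transfer carries φ over.

-- A universe into which ℕ injects is infinite (pigeonhole on n + 1 naturals).
ℕ-injects⇒infinite : {k : ℕ} (S : SLStructure k) (f : ℕ → SLStructure.U S) → Injective _≡_ _≡_ f → Infinite S
ℕ-injects⇒infinite S f f-inj (n , U↔Fin) with FP.pigeonhole (ℕP.n<1+n n) (Inverse.to U↔Fin ∘ f ∘ toℕ)
... | i , j , i<j , same = FP.<-irrefl (FP.toℕ-injective (f-inj (Injection.injective (↔⇒↣ U↔Fin) same))) i<j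

module Widen {k : ℕ} (B : SLStructure k) where
  open SLStructure B

  code⁺ : U ⊎ ℕ → ℕ
  code⁺ (inj₁ u) = 2 * code u
  code⁺ (inj₂ n) = suc (2 * n)

  code⁺-inj : Injective _≡_ _≡_ code⁺
  code⁺-inj {inj₁ u} {inj₁ u′} same = cong inj₁ (code-inj (ℕP.*-cancelˡ-≡ (code u) (code u′) 2 same))
  code⁺-inj {inj₁ u} {inj₂ n′} same = contradiction same (ℕP.even≢odd (code u) n′)
  code⁺-inj {inj₂ n} {inj₁ u′} same = contradiction (sym same) (ℕP.even≢odd (code u′) n)
  code⁺-inj {inj₂ n} {inj₂ n′} same = cong inj₂ (ℕP.*-cancelˡ-≡ n n′ 2 (ℕP.suc-injective same))

  widened : SLStructure k
  widened = record
    { U        = U ⊎ ℕ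
    ; code     = code⁺
    ; code-inj = code⁺-inj
    ; store    = Maybe.map inj₁ ∘ store
    ; heap     = record
      { cells    = map (mapCell inj₁) (Heap.cells heap)
      ; distinct = APP.map⁺ (AP.map (λ ℓ≢ℓ′ → ℓ≢ℓ′ ∘ SumP.inj₁-injective) (Heap.distinct heap)) } }

  widened-infinite : Infinite widened
  widened-infinite = ℕ-injects⇒infinite widened inj₂ SumP.inj₂-injective

  naturals-unused : (m : ℕ) → Unused widened m
  naturals-unused m = record { loc = inj₂ ∘ toℕ ; loc-inj = FP.toℕ-injective ∘ SumP.inj₂-injective ; loc-out = out }
    where
    out : ∀ j → inj₂ (toℕ j) ∉ elems (map (mapCell inj₁) (Heap.cells heap))
    out j n∈ with ∈P.∈-map⁻ inj₁ (subst (_ ∈_) (elems-map inj₁ (Heap.cells heap)) n∈)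
    ... | _ , _ , ()

  widen-model : ∀ qs {ψ} → QF ψ → Closed (prenex qs ψ)
              → B ⊨ (prenex qs ψ ∧ᶠ lambdaF k (length qs)) → widened ⊨ prenex qs ψ
  widen-model qs q closed (φ-holds , λ-holds) =
    Equivalence.from (Transfer.transfer widened B inj₁ SumP.inj₁-injective refl m
                        (naturals-unused m) (LambdaSemantics.λ-sound B store m λ-holds)
                        qs q ℕP.≤-refl closed (SLStructure.store widened) store)
      φ-holds
    where m = length qs

unique-lookup-injective : {X : Set} {xs : List X} → AllPairs _≢_ xs → Injective _≡_ _≡_ (L.lookup xs)
unique-lookup-injective (x≢xs AP.∷ _) {F.zero}  {F.zero}  _    = refl
unique-lookup-injective (x≢xs AP.∷ _) {F.zero}  {F.suc j} same = contradiction same (All.lookup x≢xs (∈P.∈-lookup j))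
unique-lookup-injective (x≢xs AP.∷ _) {F.suc i} {F.zero}  same = contradiction (sym same) (All.lookup x≢xs (∈P.∈-lookup i))
unique-lookup-injective (_ AP.∷ xs≢)  {F.suc i} {F.suc j} same = cong F.suc (unique-lookup-injective xs≢ same)

-- A list containing every location witnesses that the universe is finite:
-- after removing duplicates, positions in the list enumerate it.
covered⇒finite : {k : ℕ} (S : SLStructure k) (xs : List (SLStructure.U S))
               → (∀ u → u ∈ xs) → Finite S
covered⇒finite S xs covered = length enum , mk↔ₛ′ position (L.lookup enum) lookup∘position position∘lookup
  where
  _≟_ = decEq S
  enum = L.deduplicate _≟_ xs
  enumerated : ∀ u → u ∈ enum
  enumerated u = ∈P.∈-deduplicate⁺ _≟_ (covered u)
  position : SLStructure.U S → Fin (length enum)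
  position u = Any.index (enumerated u)
  lookup∘position : ∀ i → position (L.lookup enum i) ≡ i
  lookup∘position i = unique-lookup-injective (UniqueP.deduplicate-! _≟_ xs)
                        (sym (AnyP.lookup-index (enumerated (L.lookup enum i))))
  position∘lookup : ∀ u → L.lookup enum (position u) ≡ u
  position∘lookup u = sym (AnyP.lookup-index (enumerated u))

-- Hence no list exhausts an infinite universe.  Constructively we only get
-- the double negation of an escaping location.
infinite-escapes : {k : ℕ} (S : SLStructure k) → Infinite S
                 → (xs : List (SLStructure.U S)) → ¬ ¬ (∃ λ u → u ∉ xs)
infinite-escapes S infinite xs none = infinite (covered⇒finite S xs covered)
  where
  open DecMembership (decEq S) using (_∈?_)
  covered : ∀ u → u ∈ xs
  covered u = decidable-stable (u ∈? xs) (λ u∉ → none (u , u∉))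

Avoiding : {U : Set} → List U → ℕ → Set
Avoiding {U} xs n = Σ (Fin n → U) λ f → Injective _≡_ _≡_ f × (∀ j → f j ∉ xs)

extend-avoiding : {U : Set} {xs : List U} {n : ℕ} ((f , _ , _) : Avoiding xs n)
                → (u : U) → u ∉ xs ++ L.tabulate f → Avoiding xs (suc n)
extend-avoiding {xs = xs} (f , f-inj , f-out) u u∉ = (u VF.∷ f) , inj , out
  where
  new : ∀ j → u ≢ f j
  new j u≡fj = u∉ (∈P.∈-++⁺ʳ xs (subst (_∈ L.tabulate f) (sym u≡fj) (∈P.∈-tabulate⁺ j)))
  inj : Injective _≡_ _≡_ (u VF.∷ f)
  inj {F.zero}  {F.zero}  _    = refl
  inj {F.zero}  {F.suc j} same = contradiction same (new j)
  inj {F.suc i} {F.zero}  same = contradiction (sym same) (new i)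
  inj {F.suc i} {F.suc j} same = cong F.suc (f-inj same)
  out : ∀ j → (u VF.∷ f) j ∉ xs
  out F.zero    = u∉ ∘ ∈P.∈-++⁺ˡ
  out (F.suc j) = f-out j

open RawMonad (¬¬-Monad {lzero}) using (pure; _>>=_)

infinite-avoiding : {k : ℕ} (S : SLStructure k) → Infinite S
                  → (xs : List (SLStructure.U S)) (n : ℕ) → ¬ ¬ Avoiding xs n
infinite-avoiding S infinite xs zero    = pure ((λ ()) , (λ { {()} }) , (λ ()))
infinite-avoiding S infinite xs (suc n) = do
  family ← infinite-avoiding S infinite xs n
  u , u∉ ← infinite-escapes S infinite (xs ++ L.tabulate (proj₁ family))
  pure (extend-avoiding family u u∉)

-- In a finite structure satisfaction of prenex formulae is decidable:
-- quantifiers become finite searches and test formulae are list lookups.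
module Decide {k : ℕ} (S : SLStructure k) (finite : Finite S) where
  open SLStructure S
  private
    _≟_ = decEq S
    cs = Heap.cells heap
    Store = Var → Maybe U
    open Inverse (proj₂ finite)

  ∀? : {P : U → Set} → (∀ u → Dec (P u)) → Dec (∀ u → P u)
  ∀? {P} P? = map′ (λ P∘from u → subst P (strictlyInverseʳ u) (P∘from (to u))) (λ P-all i → P-all (from i))
                   (FP.all? (P? ∘ from))

  ∃? : {P : U → Set} → (∀ u → Dec (P u)) → Dec (Σ U P)
  ∃? {P} P? = map′ (λ { (i , p) → from i , p }) (λ { (u , p) → to u , subst P (sym (strictlyInverseʳ u)) p })
                   (FP.any? (P? ∘ from))

  ≈? : (a b : Maybe U) → Dec (∃ λ u → a ≡ just u × b ≡ just u)
  ≈? nothing  _        = no λ { (_ , () , _) }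
  ≈? (just a) nothing  = no λ { (_ , _ , ()) }
  ≈? (just a) (just b) = map′ (λ { refl → a , refl , refl }) (λ { (_ , refl , refl) → refl }) (a ≟ b)

  ↪? : (a : Maybe U) (w : Vec (Maybe U) k)
     → Dec (∃₂ λ ℓ v → a ≡ just ℓ × (ℓ , v) ∈ cs × w ≡ V.map just v)
  ↪? nothing  w = no λ { (_ , _ , () , _) }
  ↪? (just ℓ) w with Any.any? (λ c → (proj₁ c ≟ ℓ) ×-dec VP.≡-dec (MaybeP.≡-dec _≟_) w (V.map just (proj₂ c))) cs
  ... | yes found with find found
  ...   | (_ , v) , c∈ , (refl , w≡) = yes (ℓ , v , refl , c∈ , w≡)
  ↪? (just ℓ) w | no none = no λ { (_ , v , refl , c∈ , w≡) → none (Any.map (λ { refl → refl , w≡ }) c∈) }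

  alloc? : (a : Maybe U) → Dec (∃ λ ℓ → a ≡ just ℓ × ℓ ∈dom heap)
  alloc? nothing  = no λ { (_ , () , _) }
  alloc? (just ℓ) with Any.any? (λ c → proj₁ c ≟ ℓ) cs
  ... | yes found with find found
  ...   | (_ , v) , c∈ , refl = yes (ℓ , refl , v , c∈)
  alloc? (just ℓ) | no none = no λ { (_ , refl , v , c∈) → none (Any.map (λ { refl → refl }) c∈) }

  size? : (n : ℕ∞) → Dec (length cs ≥∞ n)
  size? (fin n) = n ℕ.≤? length cs
  size? ∞       = no λ ()

  decide-qf : ∀ {ψ} → QF ψ → (t : Store) → Dec (sat S t ψ)
  decide-qf (eq x y)   t = ≈? (t x) (t y)
  decide-qf (pto x ys) t = ↪? (t x) (V.map t ys)
  decide-qf (alloc x)  t = alloc? (t x)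
  decide-qf (size n)   t = size? n
  decide-qf top        t = yes tt
  decide-qf (neg q)    t = ¬? (decide-qf q t)
  decide-qf (conj q r) t = decide-qf q t ×-dec decide-qf r t
  decide-qf (disj q r) t = decide-qf q t ⊎-dec decide-qf r t

  decide-prenex : ∀ qs {ψ} → QF ψ → (t : Store) → Dec (sat S t (prenex qs ψ))
  decide-prenex []              q t = decide-qf q t
  decide-prenex ((∀q , x) ∷ qs) q t = ∀? λ u → decide-prenex qs q (t [ x ↦ u ])
  decide-prenex ((∃q , x) ∷ qs) q t = ∃? λ u → decide-prenex qs q (t [ x ↦ u ])

-- Collapse an infinite model S: keep one point for each
-- location of elems(h), add m + 1 spare points, take the image of h and
-- the empty store.  The spare points make λ_m true.  To transfer φ we
-- embed the collapsed structure back into S, sending the spare points to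
-- fresh locations; these exist only under double negation, which is
-- harmless because satisfaction in the finite structure is decidable.

module Collapse {k : ℕ} (S : SLStructure k) (m : ℕ) where
  open SLStructure S
  private
    cs = Heap.cells heap
    _≟_ = decEq S
  open DecMembership _≟_ using (_∈?_)

  heapLocs : List U
  heapLocs = L.deduplicate _≟_ (elems cs)

  heapLocs⁺ : ∀ {u} → u ∈ elems cs → u ∈ heapLocs
  heapLocs⁺ = ∈P.∈-deduplicate⁺ _≟_

  Small : Set
  Small = Fin (length heapLocs) ⊎ Fin (suc m)

  Small↔Fin : Small ↔ Fin (length heapLocs + suc m)
  Small↔Fin = mk↔ₛ′ (F.join n (suc m)) (F.splitAt n) (FP.join-splitAt n (suc m)) (FP.splitAt-join n (suc m))
    where n = length heapLocs

  -- A heap location goes to its position in heapLocs.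
  index-by : (u : U) → Dec (u ∈ heapLocs) → Small
  index-by u (yes u∈) = inj₁ (Any.index u∈)
  index-by u (no _)   = inj₂ F.zero

  index : U → Small
  index u = index-by u (u ∈? heapLocs)

  index-heap : ∀ {u} → u ∈ heapLocs → ∃ λ i → index u ≡ inj₁ i × L.lookup heapLocs i ≡ u
  index-heap {u} u∈ with u ∈? heapLocs
  ... | yes u∈′ = Any.index u∈′ , refl , sym (AnyP.lookup-index u∈′)
  ... | no u∉   = contradiction u∈ u∉

  index-inj-heap : ∀ {u u′} → u ∈ elems cs → u′ ∈ elems cs → index u ≡ index u′ → u ≡ u′
  index-inj-heap u∈ u′∈ same with index-heap (heapLocs⁺ u∈) | index-heap (heapLocs⁺ u′∈)
  ... | i , iu , lu | j , ju , lu′ with trans (sym iu) (trans same ju)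
  ... | refl = trans (sym lu) lu′

  collapsed : SLStructure k
  collapsed = record
    { U        = Small
    ; code     = toℕ ∘ Inverse.to Small↔Fin
    ; code-inj = Injection.injective (↔⇒↣ Small↔Fin) ∘ FP.toℕ-injective
    ; store    = λ _ → nothing
    ; heap     = record
      { cells    = map (mapCell index) cs
      ; distinct = AllPairs-map-within cs
                     (λ c∈ d∈ ℓ≢ℓ′ → ℓ≢ℓ′ ∘ index-inj-heap (dom⊆elems c∈) (dom⊆elems d∈))
                     (Heap.distinct heap) } }

  collapsed-finite : Finite collapsed
  collapsed-finite = _ , Small↔Fin

  -- The spare points other than inj₂ zero are unused.
  spares-unused : Unused collapsed m
  spares-unused = record { loc = inj₂ ∘ F.suc ; loc-inj = FP.suc-injective ∘ SumP.inj₂-injective ; loc-out = out }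
    where
    out : ∀ j → inj₂ (F.suc j) ∉ elems (map (mapCell index) cs)
    out j spare∈ with ∈P.∈-map⁻ index (subst (_ ∈_) (elems-map index cs) spare∈)
    ... | u , u∈ , spare≡ with index-heap (heapLocs⁺ u∈)
    ... | i , iu , _ with trans spare≡ iu
    ... | ()

  module Embed (fresh : Fin (suc m) → U) (fresh-inj : Injective _≡_ _≡_ fresh)
               (fresh-out : ∀ j → fresh j ∉ heapLocs) where

    embed : Small → U
    embed (inj₁ i) = L.lookup heapLocs i
    embed (inj₂ j) = fresh j

    embed-inj : Injective _≡_ _≡_ embed
    embed-inj {inj₁ i} {inj₁ j} same = cong inj₁ (unique-lookup-injective (UniqueP.deduplicate-! _≟_ (elems cs)) same)
    embed-inj {inj₁ i} {inj₂ j} same = contradiction (subst (_∈ heapLocs) same (∈P.∈-lookup i)) (fresh-out j)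
    embed-inj {inj₂ i} {inj₁ j} same = contradiction (subst (_∈ heapLocs) (sym same) (∈P.∈-lookup j)) (fresh-out i)
    embed-inj {inj₂ i} {inj₂ j} same = cong inj₂ (fresh-inj same)

    embed∘index : ∀ {u} → u ∈ elems cs → embed (index u) ≡ u
    embed∘index u∈ with index-heap (heapLocs⁺ u∈)
    ... | i , iu , lu = trans (cong embed iu) lu

    heap-image : cs ≡ map (mapCell embed) (map (mapCell index) cs)
    heap-image = sym (trans (sym (LP.map-∘ cs)) (LP.map-id-local (All.tabulate round-trip)))
      where
      round-trip : ∀ {c} → c ∈ cs → mapCell embed (mapCell index c) ≡ c
      round-trip c∈ = cong₂ _,_ (embed∘index (dom⊆elems c∈))
        (trans (sym (VP.map-∘ embed index _)) (vec-map-id-local _ (embed∘index ∘ ran⊆elems c∈)))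

    fresh-unused : Unused S m
    fresh-unused = record { loc = fresh ∘ F.suc ; loc-inj = FP.suc-injective ∘ fresh-inj
                          ; loc-out = λ j → fresh-out (F.suc j) ∘ heapLocs⁺ }

  collapse-model : Infinite S → ∀ qs {ψ} → QF ψ → length qs ≤ m → Closed (prenex qs ψ)
                 → S ⊨ prenex qs ψ → collapsed ⊨ (prenex qs ψ ∧ᶠ lambdaF k m)
  collapse-model infinite qs q short closed φ-holds =
    decidable-stable (Decide.decide-prenex collapsed collapsed-finite qs q _) (do
      fresh , fresh-inj , fresh-out ← infinite-avoiding S infinite heapLocs (suc m)
      let open Embed fresh fresh-inj fresh-out
      pure (Equivalence.to (Transfer.transfer S collapsed embed embed-inj heap-image m fresh-unused spares-unused
                              qs q short closed store (λ _ → nothing))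
              φ-holds))
    , LambdaSemantics.λ-complete collapsed (λ _ → nothing) m spares-unused

-- Lemma 3 combines the two constructions.
lemma3 : (k : ℕ) → 1 ≤ k → (qs : List (Quant × Var)) (ψ : Form k)
         → QF ψ → Closed (prenex qs ψ)
         → HasInfiniteModel (prenex qs ψ) ⇔ HasFiniteModel (prenex qs ψ ∧ᶠ lambdaF k (length qs))
lemma3 k _ qs ψ q closed = mk⇔ infinite⇒finite finite⇒infinite
  where
  infinite⇒finite : HasInfiniteModel (prenex qs ψ) → HasFiniteModel (prenex qs ψ ∧ᶠ lambdaF k (length qs))
  infinite⇒finite (S , infinite , φ-holds) =
    collapsed , collapsed-finite , collapse-model infinite qs q ℕP.≤-refl closed φ-holds
    where open Collapse S (length qs)

  finite⇒infinite : HasFiniteModel (prenex qs ψ ∧ᶠ lambdaF k (length qs)) → HasInfiniteModel (prenex qs ψ)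
  finite⇒infinite (B , _ , φλ-holds) = widened , widened-infinite , widen-model qs q closed φλ-holds
    where open Widen B
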